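{- Over full relational inquisitive models, the absence of infinite $R$-paths from the designated world $w$ (i.e., well-foundedness of the converse of $R$ at $w$) is a first-order definable and $\sim$-invariant property of worlds that is not preserved under $\sim^n$ for any $n$, hence not expressible in $\textsc{InqML}$. In particular, first-order logic violates compactness over full relational models.
   Context: A relational inquisitive model is a two-sorted structure $\mathfrak{M}=\langle W,S,E,\epsilon,(P_i)\rangle$ with $E,\epsilon\subseteq W\times S$, $P_i\subseteq W$, satisfying extensionality (so $S\subseteq\wp(W)$ and $\epsilon$ is membership), $E[w]\neq\emptyset$ for all $w$, and downward closure (if $s\in E[w]$ and $t\subseteq s$ then $t\in S\cap E[w]$); it is full if $S=\wp(W)$. Define $uRv$ iff $v\in s$ for some $s$ with $uEs$. First-order logic is two-sorted over $E,\epsilon,(P_i)$. $\textsc{InqML}$: $\phi::= p\mid\bot\mid\phi\land\phi\mid\phi\to\phi\mid\phi\mathbin{\bar{\vee}}\phi\mid\Box\phi\mid\boxplus\phi$ ($\mathbin{\bar{\vee}}$ inquisitive disjunction) with support semantics at states ($s\models p$ iff $s\subseteq V(p)$; $s\models\bot$ iff $s=\emptyset$; $\land$ componentwise; $s\models\phi\to\psi$ iff every $t\subseteq s$ supporting $\phi$ supports $\psi$; $s\models\phi\mathbin{\bar{\vee}}\psi$ iff $s$ supports one of them; $s\models\Box\phi$ iff $\bigcup E[w]\models\phi$ for all $w\in s$; $s\models\boxplus\phi$ iff all $t\in E[w]$, $w\in s$, support $\phi$), truth at $w$ being support at $\{w\}$. $\sim$ (resp. $\sim^n$) is inquisitive bisimilarity: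 player II wins the unbounded (resp. $n$-round) game alternating world-positions $\langle w,w'\rangle$ (I picks a state in $E[w]$ or $E'[w']$, II one on the other side) and state-positions $\langle s,s'\rangle$ (I picks a world in one state, II a world in the other), II losing if stuck or at a world-position disagreeing on an atom. -}

module Defs where

open import Level using (0ℓ)
open import Data.Nat using (ℕ; zero; suc)
open import Data.Bool using (Bool; true; false)
open import Data.Product using (Σ; _×_; _,_)
open import Data.Sum using (_⊎_)
open import Data.Empty using (⊥)
open import Data.List using (List)
open import Data.List.Relation.Unary.All using (All)
open import Data.List.Membership.Propositional using (_∈_)
open import Relation.Nullary using (¬_)
open import Relation.Binary.PropositionalEquality using (_≡_)
open import Induction.WellFounded using (Acc)

_⇔_ : Set → Set → Set
A ⇔ B = (A → B) × (B → A)
infix 3 _⇔_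

-- The state sort of a *full* model is the whole powerset of W; subsets of
-- W are represented by characteristic functions W → Bool (the theorem is
-- stated under excluded middle, so these are all subsets).  Extensionality
-- is built in (states are subsets, ε is membership).

State : Set → Set
State W = W → Bool

_∈ₛ_ : {W : Set} → W → State W → Set
v ∈ₛ s = s v ≡ true

_⊆ₛ_ : {W : Set} → State W → State W → Set
t ⊆ₛ s = ∀ v → v ∈ₛ t → v ∈ₛ s

record FullModel : Set₁ where
  field
    W          : Set
    E          : W → State W → Set
    V          : ℕ → W → Set
    E-nonempty : ∀ w → Σ (State W) (E w)
    E-down     : ∀ {w s t} → E w s → t ⊆ₛ s → E w t

open FullModel public

R : (M : FullModel) → W M → W M → Set
R M u v = Σ (State (W M)) (λ s → E M u s × v ∈ₛ s)

NoInfRPath : (M : FullModel) → W M → Set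
NoInfRPath M w = Acc (λ y x → R M x y) w

WorldProperty : Set₁
WorldProperty = (M : FullModel) → W M → Set

data FO : Set where
  atomP : ℕ → ℕ → FO
  relE  : ℕ → ℕ → FO
  memε  : ℕ → ℕ → FO
  ⊥ᶠ    : FO
  _∧ᶠ_ _∨ᶠ_ _⇒ᶠ_ : FO → FO → FO
  ∀w ∃w : ℕ → FO → FO
  ∀s ∃s : ℕ → FO → FO

update : {A : Set} → (ℕ → A) → ℕ → A → (ℕ → A)
update g zero    a zero    = a
update g zero    a (suc m) = g (suc m)
update g (suc n) a zero    = g zero
update g (suc n) a (suc m) = update (λ k → g (suc k)) n a m

Sat : (M : FullModel) → (ℕ → W M) → (ℕ → State (W M)) → FO → Set
Sat M gw gs (atomP i j) = V M i (gw j)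
Sat M gw gs (relE j k)  = E M (gw j) (gs k)
Sat M gw gs (memε j k)  = gw j ∈ₛ gs k
Sat M gw gs ⊥ᶠ          = ⊥
Sat M gw gs (φ ∧ᶠ ψ)    = Sat M gw gs φ × Sat M gw gs ψ
Sat M gw gs (φ ∨ᶠ ψ)    = Sat M gw gs φ ⊎ Sat M gw gs ψ
Sat M gw gs (φ ⇒ᶠ ψ)    = Sat M gw gs φ → Sat M gw gs ψ
Sat M gw gs (∀w x φ)    = ∀ a → Sat M (update gw x a) gs φ
Sat M gw gs (∃w x φ)    = Σ (W M) (λ a → Sat M (update gw x a) gs φ)
Sat M gw gs (∀s x φ)    = ∀ t → Sat M gw (update gs x t) φ
Sat M gw gs (∃s x φ)    = Σ (State (W M)) (λ t → Sat M gw (update gs x t) φ)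

FreeAmong : (ℕ → Set) → (ℕ → Set) → FO → Set
FreeAmong Bw Bs (atomP i j) = Bw j
FreeAmong Bw Bs (relE j k)  = Bw j × Bs k
FreeAmong Bw Bs (memε j k)  = Bw j × Bs k
FreeAmong Bw Bs ⊥ᶠ          = Data.Unit.⊤ where import Data.Unit
FreeAmong Bw Bs (φ ∧ᶠ ψ)    = FreeAmong Bw Bs φ × FreeAmong Bw Bs ψ
FreeAmong Bw Bs (φ ∨ᶠ ψ)    = FreeAmong Bw Bs φ × FreeAmong Bw Bs ψ
FreeAmong Bw Bs (φ ⇒ᶠ ψ)    = FreeAmong Bw Bs φ × FreeAmong Bw Bs ψ
FreeAmong Bw Bs (∀w x φ)    = FreeAmong (λ y → y ≡ x ⊎ Bw y) Bs φ
FreeAmong Bw Bs (∃w x φ)    = FreeAmong (λ y → y ≡ x ⊎ Bw y) Bs φ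
FreeAmong Bw Bs (∀s x φ)    = FreeAmong Bw (λ y → y ≡ x ⊎ Bs y) φ
FreeAmong Bw Bs (∃s x φ)    = FreeAmong Bw (λ y → y ≡ x ⊎ Bs y) φ

Closed : FO → Set
Closed = FreeAmong (λ _ → ⊥) (λ _ → ⊥)

FODefinable : WorldProperty → Set₁
FODefinable P =
  Σ FO (λ φ → FreeAmong (λ y → y ≡ 0) (λ _ → ⊥) φ ×
    (∀ (M : FullModel) (gw : ℕ → W M) (gs : ℕ → State (W M)) →
       Sat M gw gs φ ⇔ P M (gw 0)))

FOSatisfiable : (FO → Set) → Set₁
FOSatisfiable Γ =
  Σ FullModel (λ M → Σ (ℕ → W M) (λ gw → Σ (ℕ → State (W M)) (λ gs →
    ∀ φ → Γ φ → Sat M gw gs φ)))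

FOCompactOverFull : Set₁
FOCompactOverFull =
  ∀ (Γ : FO → Set) → (∀ φ → Γ φ → Closed φ) →
  (∀ (Δ : List FO) → All Γ Δ → FOSatisfiable (λ φ → φ ∈ Δ)) →
  FOSatisfiable Γ

AtomAgree : (M M' : FullModel) → W M → W M' → Set
AtomAgree M M' w w' = ∀ i → V M i w ⇔ V M' i w'

-- n-round game: II has a winning strategy from world-position ⟨w,w'⟩ (n rounds
-- left), resp. from state-position ⟨s,s'⟩ (then n more rounds).
mutual
  BisN : (n : ℕ) → (M M' : FullModel) → W M → W M' → Set
  BisN zero    M M' w w' = AtomAgree M M' w w'
  BisN (suc n) M M' w w' =
    AtomAgree M M' w w' ×
    (∀ s  → E M w s → Σ (State (W M')) (λ s' → E M' w' s' × StBisN n M M' s s')) ×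
    (∀ s' → E M' w' s' → Σ (State (W M)) (λ s → E M w s × StBisN n M M' s s'))

  StBisN : (n : ℕ) → (M M' : FullModel) → State (W M) → State (W M') → Set
  StBisN n M M' s s' =
    (∀ v  → v ∈ₛ s → Σ (W M') (λ v' → v' ∈ₛ s' × BisN n M M' v v')) ×
    (∀ v' → v' ∈ₛ s' → Σ (W M) (λ v → v ∈ₛ s × BisN n M M' v v'))

record IsInqBisim (M M' : FullModel) (Z : W M → W M' → Set)
                  (Zs : State (W M) → State (W M') → Set) : Set where
  field
    atoms : ∀ {w w'} → Z w w' → AtomAgree M M' w w'
    forthW : ∀ {w w'} → Z w w' → ∀ s → E M w s →
             Σ (State (W M')) (λ s' → E M' w' s' × Zs s s')
    backW  : ∀ {w w'} → Z w w' → ∀ s' → E M' w' s' →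
             Σ (State (W M)) (λ s → E M w s × Zs s s')
    forthS : ∀ {s s'} → Zs s s' → ∀ v → v ∈ₛ s →
             Σ (W M') (λ v' → v' ∈ₛ s' × Z v v')
    backS  : ∀ {s s'} → Zs s s' → ∀ v' → v' ∈ₛ s' →
             Σ (W M) (λ v → v ∈ₛ s × Z v v')

Bisimilar : (M M' : FullModel) → W M → W M' → Set₁
Bisimilar M M' w w' =
  Σ (W M → W M' → Set) (λ Z → Σ (State (W M) → State (W M') → Set) (λ Zs →
    IsInqBisim M M' Z Zs × Z w w'))

BisimInvariant : WorldProperty → Set₁
BisimInvariant P = ∀ (M M' : FullModel) w w' → Bisimilar M M' w w' → P M w ⇔ P M' w'

BisimNInvariant : ℕ → WorldProperty → Set₁
BisimNInvariant n P = ∀ (M M' : FullModel) w w' → BisN n M M' w w' → P M w ⇔ P M' w'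

data InqML : Set where
  atom  : ℕ → InqML
  ⊥ⁱ    : InqML
  _∧ⁱ_ _⇒ⁱ_ _⩒_ : InqML → InqML → InqML
  □ ⊞   : InqML → InqML

Supports : (M : FullModel) → State (W M) → InqML → Set
Supports M s (atom p)  = ∀ v → v ∈ₛ s → V M p v
Supports M s ⊥ⁱ        = ∀ v → ¬ (v ∈ₛ s)
Supports M s (φ ∧ⁱ ψ)  = Supports M s φ × Supports M s ψ
Supports M s (φ ⇒ⁱ ψ)  = ∀ t → t ⊆ₛ s → Supports M t φ → Supports M t ψ
Supports M s (φ ⩒ ψ)   = Supports M s φ ⊎ Supports M s ψ
-- s ⊨ □φ iff ⋃E[w] ⊨ φ for all w ∈ s  (t below is the state ⋃E[w] = R[w])
Supports M s (□ φ)     = ∀ w → w ∈ₛ s → ∀ t → (∀ v → v ∈ₛ t ⇔ R M w v) → Supports M t φ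
Supports M s (⊞ φ)     = ∀ w → w ∈ₛ s → ∀ t → E M w t → Supports M t φ

TrueAt : (M : FullModel) → W M → InqML → Set
TrueAt M w φ = ∀ t → (∀ v → v ∈ₛ t ⇔ v ≡ w) → Supports M t φ

InqMLExpressible : WorldProperty → Set₁
InqMLExpressible P = Σ InqML (λ φ → ∀ (M : FullModel) w → TrueAt M w φ ⇔ P M w)

-- It is
-- first-order because, over full models, the state sort ranges over all sets
-- of worlds: w has no infinite R-path iff w lies in every set that contains
-- each world all of whose R-successors it contains.  It is ∼-invariant
-- because bisimulations reflect R-steps.  Yet the infinite ascending chain
-- 0 → 1 → 2 → ⋯ and the finite descending chain n → n-1 → ⋯ → 0 are
-- n-bisimilar at their starting points, and only the second is well-founded;
-- as every InqML formula is invariant under ∼ⁿ for n its modal depth, the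
-- property is not InqML-expressible.  Compactness fails for the sentences
-- "some P₀-world has no infinite R-path" and "every Pᵢ-world has an
-- R-successor satisfying Pᵢ₊₁": each finite part holds in a long enough
-- descending chain, while the whole set forces an infinite R-path.
module Submission where

open import Defs
open import Level using (0ℓ)
open import Data.Nat using (ℕ; zero; suc; _+_; _≤_; _⊔_; s≤s)
open import Data.Nat.Properties
  using (≤-refl; ≤-reflexive; ≤-trans; m⊔n≤o⇒m≤o; m⊔n≤o⇒n≤o; m≤m⊔n; m≤n⊔m; +-suc; +-identityʳ; <-irrefl)
open import Data.Nat.Induction using (<-wellFounded)
open import Data.Bool using (false)
open import Data.Product using (Σ; _×_; _,_; proj₁; proj₂; map₂)
open import Data.Sum using (_⊎_; inj₁; inj₂)
open import Data.Empty using (⊥; ⊥-elim)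
open import Data.List using (List)
open import Data.List.Relation.Unary.All using (All; []; _∷_)
open import Data.List.Relation.Unary.Any using (here; there)
open import Data.List.Membership.Propositional using (_∈_)
open import Function using (flip)
open import Relation.Nullary using (¬_; yes; no; does)
open import Relation.Binary.PropositionalEquality using (_≡_; refl; sym; subst) renaming (trans to ≡-trans)
open import Induction.WellFounded using (Acc; acc; WellFounded; module Subrelation)
open import Axiom.ExcludedMiddle using (ExcludedMiddle)

-- States are Boolean-valued, so forming the state {v ∣ P v} needs excluded middle.
module Comprehension (em : ExcludedMiddle 0ℓ) where

  ⟦_⟧ : {A : Set} → (A → Set) → State A
  ⟦ P ⟧ v = does (em {P v})

  ∈⟦⟧ : {A : Set} (P : A → Set) (v : A) → v ∈ₛ ⟦ P ⟧ ⇔ P v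
  ∈⟦⟧ P v with em {P v}
  ... | yes p = (λ _ → p) , (λ _ → refl)
  ... | no ¬p = (λ ()) , (λ p → ⊥-elim (¬p p))

-- StBisN n M M' is definitionally EgliMilner (BisN n M M').
EgliMilner : {A B : Set} → (A → B → Set) → State A → State B → Set
EgliMilner {A} {B} Z s s' =
  (∀ v  → v ∈ₛ s  → Σ B (λ v' → v' ∈ₛ s' × Z v v')) ×
  (∀ v' → v' ∈ₛ s' → Σ A (λ v → v ∈ₛ s × Z v v'))

module _ {A B : Set} {Z : A → B → Set} where

  EgliMilner-converse : {Z' : B → A → Set} {s : State A} {s' : State B} →
                        (∀ {v v'} → Z v v' → Z' v' v) →
                        EgliMilner Z s s' → EgliMilner Z' s' s
  EgliMilner-converse f (forth , back) =
    (λ v' m' → let (v , m , z) = back v' m' in v , m , f z) ,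
    (λ v m → let (v' , m' , z) = forth v m in v' , m' , f z)

  EgliMilner-singleton : {w : A} {w' : B} {t : State A} {t' : State B} → Z w w' →
                         (∀ v → v ∈ₛ t ⇔ v ≡ w) → (∀ v' → v' ∈ₛ t' ⇔ v' ≡ w') →
                         EgliMilner Z t t'
  EgliMilner-singleton {w} {w'} z t≡w t'≡w' =
    (λ v m → w' , proj₂ (t'≡w' w') refl , subst (λ x → Z x w') (sym (proj₁ (t≡w v) m)) z) ,
    (λ v' m → w , proj₂ (t≡w w) refl , subst (Z w) (sym (proj₁ (t'≡w' v') m)) z)

  module _ (em : ExcludedMiddle 0ℓ) where
    open Comprehension em

    EgliMilner-image : {P : A → Set} {P' : B → Set} {s : State A} →
                       (∀ v → P v → Σ B (λ v' → P' v' × Z v v')) → (∀ v → v ∈ₛ s → P v) →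
                       Σ (State B) (λ s' → (∀ v' → v' ∈ₛ s' → P' v') × EgliMilner Z s s')
    EgliMilner-image {P' = P'} {s} forth s⊆P =
      ⟦ Hit ⟧ ,
      (λ v' m → proj₁ (proj₁ (∈⟦⟧ Hit _) m)) ,
      (λ v m → let (v' , p' , z) = forth v (s⊆P v m) in
               v' , proj₂ (∈⟦⟧ Hit _) (p' , v , m , z) , z) ,
      (λ v' m → proj₂ (proj₁ (∈⟦⟧ Hit _) m))
      where
      Hit : B → Set
      Hit v' = P' v' × Σ A (λ v → v ∈ₛ s × Z v v')

    EgliMilner-restrictʳ : {s : State A} {s' t' : State B} → EgliMilner Z s s' → t' ⊆ₛ s' →
                           Σ (State A) (λ t → t ⊆ₛ s × EgliMilner Z t t')
    EgliMilner-restrictʳ {s} {t' = t'} (_ , back) t'⊆s' =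
      ⟦ Hit ⟧ ,
      (λ v m → proj₁ (proj₁ (∈⟦⟧ Hit _) m)) ,
      (λ v m → proj₂ (proj₁ (∈⟦⟧ Hit _) m)) ,
      (λ v' m → let (v , mv , z) = back v' (t'⊆s' v' m) in
                v , proj₂ (∈⟦⟧ Hit _) (mv , v' , m , z) , z)
      where
      Hit : A → Set
      Hit v = v ∈ₛ s × Σ B (λ v' → v' ∈ₛ t' × Z v v')

AtomAgree-sym : {M M' : FullModel} {w : W M} {w' : W M'} →
                AtomAgree M M' w w' → AtomAgree M' M w' w
AtomAgree-sym a i = proj₂ (a i) , proj₁ (a i)

BisN⇒AtomAgree : ∀ n {M M' w w'} → BisN n M M' w w' → AtomAgree M M' w w'
BisN⇒AtomAgree zero    b = b
BisN⇒AtomAgree (suc n) b = proj₁ b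

BisN-sym : ∀ n {M M' w w'} → BisN n M M' w w' → BisN n M' M w' w
BisN-sym zero    {M} {M'} {w} {w'} b = AtomAgree-sym {M} {M'} {w} {w'} b
BisN-sym (suc n) {M} {M'} {w} {w'} (a , forth , back) =
  AtomAgree-sym {M} {M'} {w} {w'} a ,
  (λ s' e' → let (s , e , st) = back s' e' in s , e , StBisN-sym st) ,
  (λ s e → let (s' , e' , st) = forth s e in s' , e' , StBisN-sym st)
  where
  StBisN-sym : ∀ {M M' s s'} → StBisN n M M' s s' → StBisN n M' M s' s
  StBisN-sym = EgliMilner-converse (BisN-sym n)

StBisN-successors : ∀ {n M M' w w' t t'} → BisN (suc n) M M' w w' →
                  (∀ v → v ∈ₛ t ⇔ R M w v) → (∀ v' → v' ∈ₛ t' ⇔ R M' w' v') →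
                  StBisN n M M' t t'
StBisN-successors (_ , forth , back) t≡R t'≡R' =
  (λ v m → let (s , e , v∈s) = proj₁ (t≡R v) m
               (s' , e' , st) = forth s e
               (v' , v'∈s' , b) = proj₁ st v v∈s
           in v' , proj₂ (t'≡R' v') (s' , e' , v'∈s') , b) ,
  (λ v' m → let (s' , e' , v'∈s') = proj₁ (t'≡R' v') m
                (s , e , st) = back s' e'
                (v , v∈s , b) = proj₂ st v' v'∈s'
            in v , proj₂ (t≡R v) (s , e , v∈s) , b)

depth : InqML → ℕ
depth (atom _) = 0
depth ⊥ⁱ       = 0
depth (φ ∧ⁱ ψ) = depth φ ⊔ depth ψ
depth (φ ⇒ⁱ ψ) = depth φ ⊔ depth ψ
depth (φ ⩒ ψ)  = depth φ ⊔ depth ψ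
depth (□ φ)    = suc (depth φ)
depth (⊞ φ)    = suc (depth φ)

module _ (em : ExcludedMiddle 0ℓ) where
  open Comprehension em

  Supports-transfer : ∀ φ {n M M' s s'} → depth φ ≤ n → StBisN n M M' s s' →
                      Supports M s φ → Supports M' s' φ
  Supports-transfer (atom p) {n} _ (_ , back) h v' m =
    let (v , mv , b) = back v' m in proj₁ (BisN⇒AtomAgree n b p) (h v mv)
  Supports-transfer ⊥ⁱ _ (_ , back) h v' m =
    let (v , mv , _) = back v' m in h v mv
  Supports-transfer (φ ∧ⁱ ψ) d st (hφ , hψ) =
    Supports-transfer φ (m⊔n≤o⇒m≤o (depth φ) _ d) st hφ ,
    Supports-transfer ψ (m⊔n≤o⇒n≤o (depth φ) _ d) st hψ
  Supports-transfer (φ ⩒ ψ) d st (inj₁ hφ) = inj₁ (Supports-transfer φ (m⊔n≤o⇒m≤o (depth φ) _ d) st hφ)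
  Supports-transfer (φ ⩒ ψ) d st (inj₂ hψ) = inj₂ (Supports-transfer ψ (m⊔n≤o⇒n≤o (depth φ) _ d) st hψ)
  Supports-transfer (φ ⇒ⁱ ψ) {n} d st h t' t'⊆s' hφ' =
    let (t , t⊆s , stt) = EgliMilner-restrictʳ em st t'⊆s'
        hφ = Supports-transfer φ (m⊔n≤o⇒m≤o (depth φ) _ d) (EgliMilner-converse (BisN-sym n) stt) hφ'
    in Supports-transfer ψ (m⊔n≤o⇒n≤o (depth φ) _ d) stt (h t t⊆s hφ)
  Supports-transfer (⊞ φ) (s≤s d) (_ , back) h w' mw' t' e' =
    let (w , mw , (_ , _ , backₛ)) = back w' mw'
        (t , e , stt) = backₛ t' e'
    in Supports-transfer φ d stt (h w mw t e)
  Supports-transfer (□ φ) {M = M} (s≤s d) (_ , back) h w' mw' t' t'≡R' =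
    let (w , mw , b) = back w' mw'
    in Supports-transfer φ d (StBisN-successors b (∈⟦⟧ (R M w)) t'≡R')
         (h w mw ⟦ R M w ⟧ (∈⟦⟧ (R M w)))

  InqML-BisimNInvariant : ∀ φ → BisimNInvariant (depth φ) (λ M w → TrueAt M w φ)
  InqML-BisimNInvariant φ M M' w w' b =
    transfer b , transfer (BisN-sym (depth φ) b)
    where
    transfer : ∀ {N N' u u'} → BisN (depth φ) N N' u u' → TrueAt N u φ → TrueAt N' u' φ
    transfer {u = u} b h t' t'≡u' =
      Supports-transfer φ ≤-refl (EgliMilner-singleton b (∈⟦⟧ (_≡ u)) t'≡u')
        (h ⟦ _≡ u ⟧ (∈⟦⟧ (_≡ u)))

  InqMLExpressible⇒BisimNInvariant : ∀ {P} → InqMLExpressible P → Σ ℕ (λ n → BisimNInvariant n P)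
  InqMLExpressible⇒BisimNInvariant (φ , φ⇔P) =
    depth φ , λ M M' w w' b →
      let (to , from) = InqML-BisimNInvariant φ M M' w w' b in
      (λ p → proj₁ (φ⇔P M' w') (to (proj₂ (φ⇔P M w) p))) ,
      (λ p → proj₁ (φ⇔P M w) (from (proj₂ (φ⇔P M' w') p)))

module _ {M M' : FullModel} {Z : W M → W M' → Set} {Zs : State (W M) → State (W M') → Set} where
  open IsInqBisim

  IsInqBisim-converse : IsInqBisim M M' Z Zs → IsInqBisim M' M (flip Z) (flip Zs)
  IsInqBisim-converse isb = record
    { atoms  = λ z → AtomAgree-sym {M} {M'} (atoms isb z)
    ; forthW = backW isb
    ; backW  = forthW isb
    ; forthS = backS isb
    ; backS  = forthS isb
    }

  R-back : IsInqBisim M M' Z Zs → ∀ {w w' v'} → Z w w' → R M' w' v' →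
           Σ (W M) (λ v → R M w v × Z v v')
  R-back isb z (s' , e' , v'∈s') =
    let (s , e , zs) = backW isb z s' e'
        (v , v∈s , zv) = backS isb zs _ v'∈s'
    in v , (s , e , v∈s) , zv

  NoInfRPath-transfer : IsInqBisim M M' Z Zs → ∀ {w w'} → Z w w' →
                        NoInfRPath M w → NoInfRPath M' w'
  NoInfRPath-transfer isb z (acc rs) =
    acc λ r' → let (_ , r , zv) = R-back isb z r' in NoInfRPath-transfer isb zv (rs r)

NoInfRPath-bisimInvariant : BisimInvariant NoInfRPath
NoInfRPath-bisimInvariant M M' w w' (Z , Zs , isb , z) =
  NoInfRPath-transfer isb z , NoInfRPath-transfer (IsInqBisim-converse isb) z

_Rᶠ_ : ℕ → ℕ → FO
j Rᶠ k = ∃s 1 (relE j 1 ∧ᶠ memε k 1)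

-- x₀ belongs to every state S₀ that contains each world all of whose R-successors lie in S₀.
noInfRPathᶠ : FO
noInfRPathᶠ = ∀s 0 ((∀w 1 ((∀w 2 ((1 Rᶠ 2) ⇒ᶠ memε 2 0)) ⇒ᶠ memε 1 0)) ⇒ᶠ memε 0 0)

noInfRPathᶠ-freeAmong : ∀ {Bw Bs} → Bw 0 → FreeAmong Bw Bs noInfRPathᶠ
noInfRPathᶠ-freeAmong b0 =
  ((((inj₂ (inj₁ refl) , inj₁ refl) , (inj₁ refl , inj₁ refl)) , (inj₁ refl , inj₁ refl)) ,
    (inj₁ refl , inj₁ refl)) ,
  (b0 , inj₁ refl)

Sat-noInfRPathᶠ⁺ : ∀ M gw gs → NoInfRPath M (gw 0) → Sat M gw gs noInfRPathᶠ
Sat-noInfRPathᶠ⁺ M gw gs a t t-closed = go a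
  where
  go : ∀ {x} → NoInfRPath M x → x ∈ₛ t
  go {x} (acc rs) = t-closed x (λ y r → go (rs r))

module _ (em : ExcludedMiddle 0ℓ) where
  open Comprehension em

  Sat-noInfRPathᶠ⁻ : ∀ M gw gs → Sat M gw gs noInfRPathᶠ → NoInfRPath M (gw 0)
  Sat-noInfRPathᶠ⁻ M gw gs h = from (h ⟦ NoInfRPath M ⟧ closed)
    where
    from : ∀ {x} → x ∈ₛ ⟦ NoInfRPath M ⟧ → NoInfRPath M x
    from = proj₁ (∈⟦⟧ (NoInfRPath M) _)

    closed : ∀ x → (∀ y → R M x y → y ∈ₛ ⟦ NoInfRPath M ⟧) → x ∈ₛ ⟦ NoInfRPath M ⟧
    closed x succs-closed = proj₂ (∈⟦⟧ (NoInfRPath M) x) (acc λ r → from (succs-closed _ r))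

  NoInfRPath-FODefinable : FODefinable NoInfRPath
  NoInfRPath-FODefinable =
    noInfRPathᶠ ,
    noInfRPathᶠ-freeAmong {λ y → y ≡ 0} {λ _ → ⊥} refl ,
    λ M gw gs → Sat-noInfRPathᶠ⁻ M gw gs , Sat-noInfRPathᶠ⁺ M gw gs

record KripkeModel : Set₁ where
  field
    Point : Set
    Succ  : Point → Point → Set
    Val   : ℕ → Point → Set

open KripkeModel

fullModel : KripkeModel → FullModel
fullModel K = record
  { W          = Point K
  ; E          = λ w s → ∀ v → v ∈ₛ s → Succ K w v
  ; V          = Val K
  ; E-nonempty = λ _ → (λ _ → false) , λ _ ()
  ; E-down     = λ s⊆succ t⊆s v v∈t → s⊆succ v (t⊆s v v∈t)
  }

R⇒Succ : ∀ K {u v} → R (fullModel K) u v → Succ K u v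
R⇒Succ K (s , s⊆succ , v∈s) = s⊆succ _ v∈s

KBisN : ℕ → (K K' : KripkeModel) → Point K → Point K' → Set
KBisN zero    K K' w w' = AtomAgree (fullModel K) (fullModel K') w w'
KBisN (suc n) K K' w w' =
  AtomAgree (fullModel K) (fullModel K') w w' ×
  (∀ v  → Succ K w v → Σ (Point K') (λ v' → Succ K' w' v' × KBisN n K K' v v')) ×
  (∀ v' → Succ K' w' v' → Σ (Point K) (λ v → Succ K w v × KBisN n K K' v v'))

module _ (em : ExcludedMiddle 0ℓ) where
  open Comprehension em

  Succ⇒R : ∀ K {u v} → Succ K u v → R (fullModel K) u v
  Succ⇒R K {v = v} uv =
    ⟦ _≡ v ⟧ , (λ x m → subst (Succ K _) (sym (proj₁ (∈⟦⟧ (_≡ v) x) m)) uv) , proj₂ (∈⟦⟧ (_≡ v) v) refl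

  NoInfRPath-fullModel : ∀ K {w} → NoInfRPath (fullModel K) w ⇔ Acc (flip (Succ K)) w
  NoInfRPath-fullModel K =
    Subrelation.accessible (Succ⇒R K) , Subrelation.accessible (R⇒Succ K)

  KBisN⇒BisN : ∀ n {K K' w w'} → KBisN n K K' w w' → BisN n (fullModel K) (fullModel K') w w'
  KBisN⇒BisN zero    b = b
  KBisN⇒BisN (suc n) (a , forth , back) =
    a ,
    (λ s s⊆succ → EgliMilner-image em (λ v vw → map₂ (map₂ (KBisN⇒BisN n)) (forth v vw)) s⊆succ) ,
    (λ s' s'⊆succ →
      let (s , s⊆succ , st) = EgliMilner-image em (λ v' vw' → map₂ (map₂ (KBisN⇒BisN n)) (back v' vw')) s'⊆succ
      in s , s⊆succ , EgliMilner-converse (λ b → b) st)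

noAtoms : ℕ → ℕ → Set
noAtoms _ _ = ⊥

ascending : KripkeModel
ascending = record { Point = ℕ ; Succ = λ j v → v ≡ suc j ; Val = noAtoms }

descending : (ℕ → ℕ → Set) → KripkeModel
descending V = record { Point = ℕ ; Succ = λ k v → suc v ≡ k ; Val = V }

ascending-notAcc : ∀ {j} → ¬ Acc (flip (Succ ascending)) j
ascending-notAcc (acc rs) = ascending-notAcc (rs refl)

descending-wellFounded : ∀ V → WellFounded (flip (Succ (descending V)))
descending-wellFounded V = Subrelation.wellFounded ≤-reflexive <-wellFounded

ascending-KBisN-descending : ∀ {m j k} → m ≤ k → KBisN m ascending (descending noAtoms) j k
ascending-KBisN-descending {zero}          _         = λ _ → (λ ()) , (λ ())
ascending-KBisN-descending {suc m} {j} {suc k} (s≤s m≤k) =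
  (λ _ → (λ ()) , (λ ())) ,
  (λ { _ refl → k , refl , ascending-KBisN-descending m≤k }) ,
  (λ { _ refl → suc j , refl , ascending-KBisN-descending m≤k })

NoInfRPath-notBisimNInvariant : ExcludedMiddle 0ℓ → ∀ n → ¬ BisimNInvariant n NoInfRPath
NoInfRPath-notBisimNInvariant em n invariant =
  ascending-notAcc (proj₁ (NoInfRPath-fullModel em ascending) ascending-wf)
  where
  ascending-wf : NoInfRPath (fullModel ascending) 0
  ascending-wf =
    proj₂ (invariant _ _ 0 n (KBisN⇒BisN em n (ascending-KBisN-descending ≤-refl)))
      (proj₂ (NoInfRPath-fullModel em (descending noAtoms)) (descending-wellFounded noAtoms n))

startᶠ : FO
startᶠ = ∃w 0 (atomP 0 0 ∧ᶠ noInfRPathᶠ)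

stepᶠ : ℕ → FO
stepᶠ i = ∀w 0 (atomP i 0 ⇒ᶠ ∃w 1 (atomP (suc i) 1 ∧ᶠ (0 Rᶠ 1)))

data ChainAxiom : FO → Set where
  start : ChainAxiom startᶠ
  step  : ∀ i → ChainAxiom (stepᶠ i)

ChainAxiom-closed : ∀ φ → ChainAxiom φ → Closed φ
ChainAxiom-closed _ start    =
  inj₁ refl , noInfRPathᶠ-freeAmong {λ y → y ≡ 0 ⊎ ⊥} {λ _ → ⊥} (inj₁ refl)
ChainAxiom-closed _ (step i) = inj₁ refl , inj₁ refl , (inj₂ (inj₁ refl) , inj₁ refl) , (inj₁ refl , inj₁ refl)

ChainAxiom-unsatisfiable : ExcludedMiddle 0ℓ → ¬ FOSatisfiable ChainAxiom
ChainAxiom-unsatisfiable em (M , gw , gs , sat) =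
  let (x , P₀x , x-wf) = sat startᶠ start in
  noInfRPath-violated P₀x (Sat-noInfRPathᶠ⁻ em M (update gw 0 x) gs x-wf)
  where
  noInfRPath-violated : ∀ {i x} → V M i x → ¬ NoInfRPath M x
  noInfRPath-violated {i} {x} Pᵢx (acc rs) =
    let (_ , Pᵢ₊₁y , r) = sat (stepᶠ i) (step i) x Pᵢx in noInfRPath-violated Pᵢ₊₁y (rs r)

rank : ∀ {φ} → ChainAxiom φ → ℕ
rank start    = 0
rank (step i) = suc i

-- Pᵢ holds exactly at the world N - i, so the chain realises the first N step axioms.
countdown : ℕ → ℕ → ℕ → Set
countdown N i x = x + i ≡ N

Sat-ChainAxiom : ExcludedMiddle 0ℓ → ∀ N gw gs {φ} (a : ChainAxiom φ) → rank a ≤ N →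
                 Sat (fullModel (descending (countdown N))) gw gs φ
Sat-ChainAxiom em N gw gs start _ =
  N , +-identityʳ N ,
  Sat-noInfRPathᶠ⁺ (fullModel (descending (countdown N))) (update gw 0 N) gs
    (proj₂ (NoInfRPath-fullModel em (descending (countdown N))) (descending-wellFounded (countdown N) N))
Sat-ChainAxiom em N gw gs (step i) i<N zero i≡N = ⊥-elim (<-irrefl i≡N i<N)
Sat-ChainAxiom em N gw gs (step i) i<N (suc x) x+i≡N =
  x , ≡-trans (+-suc x i) x+i≡N , Succ⇒R em (descending (countdown N)) refl

All-bounded : {A : Set} {P : A → Set} (f : ∀ {x} → P x → ℕ) {xs : List A} → All P xs →
              Σ ℕ (λ N → ∀ {x} → x ∈ xs → Σ (P x) (λ p → f p ≤ N))
All-bounded f []       = 0 , λ ()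
All-bounded f (p ∷ ps) =
  let (N , bounded) = All-bounded f ps in
  f p ⊔ N ,
  λ { (here refl) → p , m≤m⊔n (f p) N
    ; (there x∈xs) → let (q , fq≤N) = bounded x∈xs in q , ≤-trans fq≤N (m≤n⊔m (f p) N) }

ChainAxiom-finitelySatisfiable : ExcludedMiddle 0ℓ → ∀ Δ → All ChainAxiom Δ → FOSatisfiable (_∈ Δ)
ChainAxiom-finitelySatisfiable em Δ axioms =
  let (N , bounded) = All-bounded rank axioms in
  fullModel (descending (countdown N)) , (λ _ → 0) , (λ _ _ → false) ,
  λ φ φ∈Δ → let (a , a≤N) = bounded φ∈Δ in Sat-ChainAxiom em N _ _ a a≤N

FO-notCompactOverFull : ExcludedMiddle 0ℓ → ¬ FOCompactOverFull
FO-notCompactOverFull em compact =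
  ChainAxiom-unsatisfiable em
    (compact ChainAxiom ChainAxiom-closed (ChainAxiom-finitelySatisfiable em))

mainTheorem6 : ExcludedMiddle 0ℓ →
    FODefinable NoInfRPath ×
    BisimInvariant NoInfRPath ×
    (∀ (n : ℕ) → ¬ BisimNInvariant n NoInfRPath) ×
    ¬ InqMLExpressible NoInfRPath ×
    ¬ FOCompactOverFull
mainTheorem6 em =
  NoInfRPath-FODefinable em ,
  NoInfRPath-bisimInvariant ,
  NoInfRPath-notBisimNInvariant em ,
  (λ expressible → let (n , invariant) = InqMLExpressible⇒BisimNInvariant em expressible in
                   NoInfRPath-notBisimNInvariant em n invariant) ,
  FO-notCompactOverFull em
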